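{- Let $k\ge1$ and let $L$ be a $4$-interval-list-assignment of the cycle $C_{2k+1}$. Then $C_{2k+1}$ admits an $L$-$(7,2)$-colouring if and only if $L$ is not uniform.
   Context: Colours are elements of $\{0,1,\dots,6\}$, viewed modulo $7$. A $4$-interval-list-assignment assigns to each vertex $v$ a list $L(v)$ consisting of exactly $4$ cyclically consecutive colours $\{c,c+1,c+2,c+3\}$ (mod $7$). $L$ is uniform if all vertices receive the same list. An $L$-$(7,2)$-colouring is a map $f$ with $f(v)\in L(v)$ for all $v$ and $2\le|f(u)-f(v)|\le5$ for every edge $uv$. -}

module Defs where

open import Data.Nat using (ℕ; suc; _+_; _∸_; _<_; _≤_; _%_)
open import Data.Fin using (Fin; toℕ)
open import Data.Product using (_×_)
open import Data.Sum using (_⊎_)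
open import Relation.Binary.PropositionalEquality using (_≡_)

Colour : Set
Colour = Fin 7

-- A 4-interval-list-assignment of the graph on Fin n: each vertex v gets
-- the list {c, c+1, c+2, c+3} (mod 7), recorded by its starting colour c = L v.
-- (Four cyclically consecutive colours in Z_7 determine c uniquely.)
IntervalListAssignment : ℕ → Set
IntervalListAssignment n = Fin n → Colour

InList : Colour → Colour → Set
InList c x = ((toℕ x + 7) ∸ toℕ c) % 7 < 4

absDiff : ℕ → ℕ → ℕ
absDiff a b = (a ∸ b) + (b ∸ a)

Separated : Colour → Colour → Set
Separated a b = (2 ≤ absDiff (toℕ a) (toℕ b)) × (absDiff (toℕ a) (toℕ b) ≤ 5)

CycleEdge : (n : ℕ) → Fin n → Fin n → Set
CycleEdge n u v = (suc (toℕ u) ≡ toℕ v) ⊎ ((suc (toℕ u) ≡ n) × (toℕ v ≡ 0))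

IsL72Colouring : (n : ℕ) → IntervalListAssignment n → (Fin n → Colour) → Set
IsL72Colouring n L f =
  ((v : Fin n) → InList (L v) (f v)) ×
  ((u v : Fin n) → CycleEdge n u v → Separated (f u) (f v))

Uniform : (n : ℕ) → IntervalListAssignment n → Set
Uniform n L = (u v : Fin n) → L u ≡ L v

module Submission where

-- A uniform list {c,…,c+3} splits into the halves {c,c+1} and {c+2,c+3}, and two separated colours of it
-- lie in different halves; so a colouring of a uniform odd cycle would 2-colour it.
--
-- Conversely, cut the cycle at v₀, whose list starts at c₀, and follow along the resulting path the sets of
-- colours reachable from c₀ and from c₀+3. A list contains two colours at distance 3 and every colour is
-- separated from one of them, so once a reachable set is a whole list it stays one, and then it closes the
-- cycle. Until that happens the pair of sets runs through a finite automaton (27 states for each c₀), and an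
-- exhaustive search shows that each of its states reached after the lists have changed closes the cycle.

open import Defs
open import Data.Nat using (ℕ; zero; suc; _+_; _*_; _∸_; _%_; _≤_; _<_; _≤?_; _<?_; z≤n; s≤s; s≤s⁻¹)
open import Data.Nat.Properties using (≤-refl; ≤-trans; <⇒≤; n≤1+n; m≤n+m; n≮n; +-comm; *-suc; suc-injective; m<1+n⇒m<n∨m≡n)
open import Data.Nat.DivMod using (_mod_; m≤n⇒m%n≡m)
open import Data.Nat.GeneralisedArithmetic using (iterate)
open import Data.Bool using (Bool; true; false; _∨_; not; T)
open import Data.Bool.Properties using (T-∨; not-¬; not-involutive) renaming (_≟_ to _≟ᵇ_)
open import Data.Fin using (Fin; toℕ)
import Data.Fin as Fin
open import Data.Fin.Properties using (any?; all?; ¬∀⟶∃¬; toℕ-fromℕ<; toℕ-injective; toℕ<n)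
  renaming (_≟_ to _≟ᶜ_)
open import Data.Fin.Subset using (Subset; ⁅_⁆; _∈_)
open import Data.Fin.Subset.Properties using (_∈?_; x∈⁅y⁆⇒x≡y)
open import Data.Vec using (tabulate; lookup)
open import Data.Vec.Properties using (lookup∘tabulate; []=⇒lookup; lookup⇒[]=)
import Data.Vec.Properties as Vec
open import Data.List using (List; []; _∷_; _++_; concatMap; deduplicate; allFin)
open import Data.List.Relation.Unary.All using (All)
import Data.List.Relation.Unary.All as All
open import Data.Product using (Σ; ∃; ∃₂; _×_; _,_; proj₁; proj₂)
open import Data.Product.Properties using (≡-dec)
open import Data.Sum using (_⊎_; inj₁; inj₂)
open import Function.Bundles using (_⇔_; mk⇔; Equivalence)
open import Relation.Binary using (DecidableEquality)
open import Function using (_∘_)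
open import Relation.Binary.PropositionalEquality using (_≡_; _≢_; refl; sym; trans; cong; subst; subst₂; module ≡-Reasoning)
open import Relation.Nullary using (Dec; yes; no; does; ¬_; contradiction)
open import Relation.Nullary.Decidable using (_×-dec_; _⊎-dec_; _→-dec_; T?; toWitness; dec-true)

InList? : ∀ c x → Dec (InList c x)
InList? c x = _ <? 4

Separated? : ∀ a b → Dec (Separated a b)
Separated? a b = (2 ≤? absDiff (toℕ a) (toℕ b)) ×-dec (absDiff (toℕ a) (toℕ b) ≤? 5)

top : Colour → Colour
top c = (toℕ c + 3) mod 7

list-bottom : ∀ c → InList c c
list-bottom = toWitness {a? = all? λ c → InList? c c} _

list-top : ∀ c → InList c (top c)
list-top = toWitness {a? = all? λ c → InList? c (top c)} _

bottom-or-top-separated : ∀ c y → Separated c y ⊎ Separated (top c) y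
bottom-or-top-separated = toWitness {a? = all? λ c → all? λ y → Separated? c y ⊎-dec Separated? (top c) y} _

list-escapes-neighbourhood : ∀ c a → ∃ λ y → InList c y × Separated y a
list-escapes-neighbourhood = toWitness {a? = all? λ c → all? λ a → any? λ y → InList? c y ×-dec Separated? y a} _

ColourSet : Set
ColourSet = Subset 7

Follows : Colour → ColourSet → Colour → Set
Follows c S y = InList c y × ∃ λ z → z ∈ S × Separated z y

follows? : ∀ c S y → Dec (Follows c S y)
follows? c S y = InList? c y ×-dec any? λ z → z ∈? S ×-dec Separated? z y

advance : Colour → ColourSet → ColourSet
advance c S = tabulate λ y → does (follows? c S y)

does-true : ∀ {A : Set} (a? : Dec A) → does a? ≡ true → A
does-true (yes a) _ = a

∈-advance : ∀ c S {y} → y ∈ advance c S ⇔ Follows c S y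
∈-advance c S {y} = mk⇔
  (λ y∈ → does-true (follows? c S y) (trans (sym entry) ([]=⇒lookup y∈)))
  (λ f → lookup⇒[]= y (advance c S) (trans entry (dec-true (follows? c S y) f)))
  where
  entry : lookup (advance c S) y ≡ does (follows? c S y)
  entry = lookup∘tabulate (λ y → does (follows? c S y)) y

Full : Colour → ColourSet → Set
Full c S = ∀ y → InList c y → y ∈ S

full? : ∀ c S → Dec (Full c S)
full? c S = all? λ y → InList? c y →-dec y ∈? S

full-advance : ∀ c c′ S → Full c S → Full c′ (advance c′ S)
full-advance c c′ S full y y∈c′ with bottom-or-top-separated c y
... | inj₁ c-y = Equivalence.from (∈-advance c′ S) (y∈c′ , c , full c (list-bottom c) , c-y)
... | inj₂ t-y = Equivalence.from (∈-advance c′ S) (y∈c′ , top c , full (top c) (list-top c) , t-y)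

CanClose : Colour → ColourSet → Set
CanClose a S = ∃ λ y → y ∈ S × Separated y a

canClose? : ∀ a S → Dec (CanClose a S)
canClose? a S = any? λ y → y ∈? S ×-dec Separated? y a

full-canClose : ∀ c S a → Full c S → CanClose a S
full-canClose c S a full with list-escapes-neighbourhood c a
... | y , y∈c , y-a = y , full y y∈c , y-a

record PathColouring (ℓ : ℕ → Colour) (m : ℕ) (a b : Colour) : Set where
  field
    colour    : ℕ → Colour
    first     : colour 0 ≡ a
    last      : colour m ≡ b
    in-list   : ∀ i → i ≤ m → InList (ℓ i) (colour i)
    separated : ∀ i → i < m → Separated (colour i) (colour (suc i))

trivialPath : ∀ {ℓ a} → InList (ℓ 0) a → PathColouring ℓ 0 a a
trivialPath {ℓ} {a} a∈ = record
  { colour = λ _ → a ; first = refl ; last = refl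
  ; in-list = λ { zero _ → a∈ } ; separated = λ _ () }

extendPath : ∀ {ℓ m a b c} → PathColouring ℓ m a b → InList (ℓ (suc m)) c → Separated b c →
             PathColouring ℓ (suc m) a c
extendPath {ℓ} {m} {a} {b} {c} P c∈ b-c = record
  { colour = colour′ ; first = trans (below z≤n) first ; last = at-end
  ; in-list = in-list′ ; separated = separated′ }
  where
  open PathColouring P
  colour′ : ℕ → Colour
  colour′ i with i ≤? m
  ... | yes _ = colour i
  ... | no  _ = c
  below : ∀ {i} → i ≤ m → colour′ i ≡ colour i
  below {i} i≤m with i ≤? m
  ... | yes _    = refl
  ... | no  i≰m = contradiction i≤m i≰m
  at-end : colour′ (suc m) ≡ c
  at-end with suc m ≤? m
  ... | yes m<m = contradiction m<m (n≮n m)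
  ... | no  _   = refl
  in-list′ : ∀ i → i ≤ suc m → InList (ℓ i) (colour′ i)
  in-list′ i i≤ with m<1+n⇒m<n∨m≡n (s≤s i≤)
  ... | inj₁ i<sm  = subst (InList (ℓ i)) (sym (below (s≤s⁻¹ i<sm))) (in-list i (s≤s⁻¹ i<sm))
  ... | inj₂ refl  = subst (InList (ℓ (suc m))) (sym at-end) c∈
  separated′ : ∀ i → i < suc m → Separated (colour′ i) (colour′ (suc i))
  separated′ i i< with m<1+n⇒m<n∨m≡n i<
  ... | inj₁ i<m  = subst₂ Separated (sym (below (<⇒≤ i<m))) (sym (below i<m)) (separated i i<m)
  ... | inj₂ refl = subst₂ Separated (sym (trans (below ≤-refl) last)) (sym at-end) b-c

reach : (ℓ : ℕ → Colour) → Colour → ℕ → ColourSet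
reach ℓ a zero    = ⁅ a ⁆
reach ℓ a (suc m) = advance (ℓ (suc m)) (reach ℓ a m)

reach-sound : ∀ ℓ {a b} m → InList (ℓ 0) a → b ∈ reach ℓ a m → PathColouring ℓ m a b
reach-sound ℓ zero a∈ b∈ rewrite x∈⁅y⁆⇒x≡y _ b∈ = trivialPath a∈
reach-sound ℓ (suc m) a∈ b∈ with Equivalence.to (∈-advance (ℓ (suc m)) (reach ℓ _ m)) b∈
... | b∈ℓ , z , z∈ , z-b = extendPath (reach-sound ℓ m a∈ z∈) b∈ℓ z-b

-- (whether some list has differed from the first one c₀, colours reachable from c₀, colours reachable from top c₀)
State : Set
State = Bool × ColourSet × ColourSet

_≟ˢ_ : DecidableEquality State
_≟ˢ_ = ≡-dec _≟ᵇ_ (≡-dec (Vec.≡-dec _≟ᵇ_) (Vec.≡-dec _≟ᵇ_))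

open import Data.List.Membership.DecPropositional _≟ˢ_ using () renaming (_∈_ to _∈ˡ_; _∈?_ to _∈ˡ?_)

start : Colour → State
start c₀ = false , ⁅ c₀ ⁆ , ⁅ top c₀ ⁆

step : (c₀ c : Colour) → State → State
step c₀ c (changed , S , S′) = changed ∨ not (does (c ≟ᶜ c₀)) , advance c S , advance c S′

Escaped : Colour → State → Set
Escaped c (_ , S , S′) = Full c S ⊎ Full c S′

escaped? : ∀ c s → Dec (Escaped c s)
escaped? c (_ , S , S′) = full? c S ⊎-dec full? c S′

Closes : Colour → State → Set
Closes c₀ (_ , S , S′) = CanClose c₀ S ⊎ CanClose (top c₀) S′

closes? : ∀ c₀ s → Dec (Closes c₀ s)
closes? c₀ (_ , S , S′) = canClose? c₀ S ⊎-dec canClose? (top c₀) S′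

grow : Colour → List State → List State
grow c₀ xs = deduplicate _≟ˢ_ (xs ++ concatMap successors xs)
  where
  unlessEscaped : Colour → State → List State
  unlessEscaped c t with escaped? c t
  ... | yes _ = []
  ... | no  _ = t ∷ []
  successors : State → List State
  successors s = concatMap (λ c → unlessEscaped c (step c₀ c s)) (allFin 7)

ClosedUnderStep : Colour → List State → Set
ClosedUnderStep c₀ xs = All (λ s → ∀ c → Escaped c (step c₀ c s) ⊎ step c₀ c s ∈ˡ xs) xs

closedUnderStep? : ∀ c₀ xs → Dec (ClosedUnderStep c₀ xs)
closedUnderStep? c₀ xs = All.all? (λ s → all? λ c → escaped? c (step c₀ c s) ⊎-dec step c₀ c s ∈ˡ? xs) xs

opaque
  -- Four rounds of growth reach the fixpoint; the fuel need not be trusted, as explored-closed certifies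
  -- closure. The block is opaque so that typechecking never unfolds explored on a symbolic c₀.
  explored : Colour → List State
  explored c₀ = iterate (grow c₀) (start c₀ ∷ []) 4

  start-explored : ∀ c₀ → start c₀ ∈ˡ explored c₀
  start-explored = toWitness {a? = all? λ c₀ → start c₀ ∈ˡ? explored c₀} _

  explored-closed : ∀ c₀ → ClosedUnderStep c₀ (explored c₀)
  explored-closed = toWitness {a? = all? λ c₀ → closedUnderStep? c₀ (explored c₀)} _

  explored-closes : ∀ c₀ → All (λ s → T (proj₁ s) → Closes c₀ s) (explored c₀)
  explored-closes = toWitness {a? = all? λ c₀ → All.all? (λ s → T? (proj₁ s) →-dec closes? c₀ s) (explored c₀)} _

changed : (ℓ : ℕ → Colour) → ℕ → Bool
changed ℓ zero    = false
changed ℓ (suc m) = changed ℓ m ∨ not (does (ℓ (suc m) ≟ᶜ ℓ 0))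

pathState : (ℓ : ℕ → Colour) → ℕ → State
pathState ℓ m = changed ℓ m , reach ℓ (ℓ 0) m , reach ℓ (top (ℓ 0)) m

escaped-or-explored : ∀ ℓ m → Escaped (ℓ m) (pathState ℓ m) ⊎ pathState ℓ m ∈ˡ explored (ℓ 0)
escaped-or-explored ℓ zero = inj₂ (start-explored (ℓ 0))
escaped-or-explored ℓ (suc m) with escaped-or-explored ℓ m
... | inj₁ (inj₁ full) = inj₁ (inj₁ (full-advance (ℓ m) (ℓ (suc m)) _ full))
... | inj₁ (inj₂ full) = inj₁ (inj₂ (full-advance (ℓ m) (ℓ (suc m)) _ full))
... | inj₂ s∈        = All.lookup (explored-closed (ℓ 0)) s∈ (ℓ (suc m))

differs⇒changed : ∀ ℓ {i} m → i ≤ m → ℓ i ≢ ℓ 0 → T (changed ℓ m)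
differs⇒changed ℓ zero    z≤n ℓ0≢ℓ0 = contradiction refl ℓ0≢ℓ0
differs⇒changed ℓ (suc m) i≤ ℓi≢ℓ0 with m<1+n⇒m<n∨m≡n (s≤s i≤)
... | inj₁ i<sm = Equivalence.from (T-∨ {changed ℓ m} {not (does (ℓ (suc m) ≟ᶜ ℓ 0))})
                    (inj₁ (differs⇒changed ℓ m (s≤s⁻¹ i<sm) ℓi≢ℓ0))
... | inj₂ refl with ℓ (suc m) ≟ᶜ ℓ 0
...   | yes e = contradiction e ℓi≢ℓ0
...   | no  _ = Equivalence.from (T-∨ {changed ℓ m} {true}) (inj₂ _)

escaped-closes : ∀ c c₀ s → Escaped c s → Closes c₀ s
escaped-closes c c₀ (_ , S , S′) (inj₁ full) = inj₁ (full-canClose c S c₀ full)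
escaped-closes c c₀ (_ , S , S′) (inj₂ full) = inj₂ (full-canClose c S′ (top c₀) full)

ClosedPath : (ℓ : ℕ → Colour) → ℕ → Set
ClosedPath ℓ m = ∃₂ λ a b → PathColouring ℓ m a b × Separated b a

closes⇒closedPath : ∀ ℓ m → Closes (ℓ 0) (pathState ℓ m) → ClosedPath ℓ m
closes⇒closedPath ℓ m (inj₁ (b , b∈ , b-a)) = _ , b , reach-sound ℓ m (list-bottom (ℓ 0)) b∈ , b-a
closes⇒closedPath ℓ m (inj₂ (b , b∈ , b-a)) = _ , b , reach-sound ℓ m (list-top (ℓ 0)) b∈ , b-a

nonconstant-closedPath : ∀ ℓ {i} m → i ≤ m → ℓ i ≢ ℓ 0 → ClosedPath ℓ m
nonconstant-closedPath ℓ m i≤m ℓi≢ℓ0 = closes⇒closedPath ℓ m (closes (escaped-or-explored ℓ m))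
  where
  closes : Escaped (ℓ m) (pathState ℓ m) ⊎ pathState ℓ m ∈ˡ explored (ℓ 0) → Closes (ℓ 0) (pathState ℓ m)
  closes (inj₁ esc) = escaped-closes (ℓ m) (ℓ 0) (pathState ℓ m) esc
  closes (inj₂ s∈)  = All.lookup (explored-closes (ℓ 0)) s∈ (differs⇒changed ℓ m i≤m ℓi≢ℓ0)

vertex : ∀ m → ℕ → Fin (suc m)
vertex m i = i mod suc m

toℕ-vertex : ∀ {m i} → i ≤ m → toℕ (vertex m i) ≡ i
toℕ-vertex i≤m = trans (toℕ-fromℕ< _) (m≤n⇒m%n≡m i≤m)

vertex-toℕ : ∀ {m} (v : Fin (suc m)) → vertex m (toℕ v) ≡ v
vertex-toℕ v = toℕ-injective (toℕ-vertex (s≤s⁻¹ (toℕ<n v)))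

closedPath⇒colouring : ∀ m (L : IntervalListAssignment (suc m)) → ClosedPath (L ∘ vertex m) m →
                        Σ (Fin (suc m) → Colour) (IsL72Colouring (suc m) L)
closedPath⇒colouring m L (a , b , P , b-a) = colour ∘ toℕ , in-list′ , separated′
  where
  open PathColouring P
  in-list′ : ∀ v → InList (L v) (colour (toℕ v))
  in-list′ v = subst (λ c → InList c (colour (toℕ v))) (cong L (vertex-toℕ v)) (in-list (toℕ v) (s≤s⁻¹ (toℕ<n v)))
  separated′ : ∀ u v → CycleEdge (suc m) u v → Separated (colour (toℕ u)) (colour (toℕ v))
  separated′ u v (inj₁ su≡v) =
    subst (λ j → Separated (colour (toℕ u)) (colour j)) su≡v
      (separated (toℕ u) (subst (_≤ m) (sym su≡v) (s≤s⁻¹ (toℕ<n v))))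
  separated′ u v (inj₂ (su≡sm , v≡0)) =
    subst₂ (λ i j → Separated (colour i) (colour j)) (sym (suc-injective su≡sm)) (sym v≡0)
      (subst₂ Separated (sym last) (sym first) b-a)

nonuniform⇒colourable : ∀ m (L : IntervalListAssignment (suc m)) → ¬ Uniform (suc m) L →
                         Σ (Fin (suc m) → Colour) (IsL72Colouring (suc m) L)
nonuniform⇒colourable m L nonuniform =
  closedPath⇒colouring m L (nonconstant-closedPath (L ∘ vertex m) m (s≤s⁻¹ (toℕ<n v)) ℓv≢ℓ0)
  where
  differing : ∃ λ v → L v ≢ L Fin.zero
  differing = ¬∀⟶∃¬ (suc m) (λ v → L v ≡ L Fin.zero) (λ v → L v ≟ᶜ L Fin.zero)
                (λ same → nonuniform λ u v → trans (same u) (sym (same v)))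
  v : Fin (suc m)
  v = proj₁ differing
  ℓv≢ℓ0 : L (vertex m (toℕ v)) ≢ L Fin.zero
  ℓv≢ℓ0 = subst (_≢ L Fin.zero) (sym (cong L (vertex-toℕ v))) (proj₂ differing)

lowerHalf : Colour → Colour → Bool
lowerHalf c x = does (((toℕ x + 7) ∸ toℕ c) % 7 <? 2)

separated-switches-half : ∀ c x y → InList c x → InList c y → Separated x y → lowerHalf c y ≡ not (lowerHalf c x)
separated-switches-half = toWitness {a? = all? λ c → all? λ x → all? λ y →
  InList? c x →-dec (InList? c y →-dec (Separated? x y →-dec (lowerHalf c y ≟ᵇ not (lowerHalf c x))))} _

alternating-even : ∀ (g : ℕ → Bool) k → (∀ i → i < 2 * k → g (suc i) ≡ not (g i)) → g (2 * k) ≡ g 0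
alternating-even g zero    _   = refl
alternating-even g (suc k) alt = begin
  g (2 * suc k)         ≡⟨ cong g (*-suc 2 k) ⟩
  g (suc (suc (2 * k))) ≡⟨ alt′ (suc (2 * k)) ≤-refl ⟩
  not (g (suc (2 * k))) ≡⟨ cong not (alt′ (2 * k) (n≤1+n _)) ⟩
  not (not (g (2 * k))) ≡⟨ not-involutive _ ⟩
  g (2 * k)             ≡⟨ alternating-even g k (λ i i< → alt′ i (≤-trans i< (m≤n+m _ 2))) ⟩
  g 0                   ∎
  where
  open ≡-Reasoning
  alt′ : ∀ i → i < 2 + 2 * k → g (suc i) ≡ not (g i)
  alt′ i i< = alt i (subst (i <_) (sym (*-suc 2 k)) i<)

uniform⇒not-colourable : ∀ k (L : IntervalListAssignment (suc (2 * k))) → Uniform (suc (2 * k)) L →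
                          ¬ Σ (Fin (suc (2 * k)) → Colour) (IsL72Colouring (suc (2 * k)) L)
uniform⇒not-colourable k L uniform (f , in-list , separated) =
  not-¬ refl (trans (alternating-even half k alternates) closing)
  where
  c : Colour
  c = L Fin.zero
  in-c : ∀ v → InList c (f v)
  in-c v = subst (λ d → InList d (f v)) (uniform v Fin.zero) (in-list v)
  half : ℕ → Bool
  half i = lowerHalf c (f (vertex (2 * k) i))
  switches : ∀ i j → CycleEdge (suc (2 * k)) (vertex (2 * k) i) (vertex (2 * k) j) → half j ≡ not (half i)
  switches i j e = separated-switches-half c _ _ (in-c _) (in-c _) (separated _ _ e)
  alternates : ∀ i → i < 2 * k → half (suc i) ≡ not (half i)
  alternates i i< = switches i (suc i) (inj₁ (trans (cong suc (toℕ-vertex (<⇒≤ i<))) (sym (toℕ-vertex i<))))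
  closing : half 0 ≡ not (half (2 * k))
  closing = switches (2 * k) 0 (inj₂ (cong suc (toℕ-vertex ≤-refl) , refl))

odd-cycle : ∀ k (L : IntervalListAssignment (suc (2 * k))) →
            Σ (Fin (suc (2 * k)) → Colour) (IsL72Colouring (suc (2 * k)) L) ⇔ (¬ Uniform (suc (2 * k)) L)
odd-cycle k L = mk⇔ (λ colouring uniform → uniform⇒not-colourable k L uniform colouring)
                    (nonuniform⇒colourable (2 * k) L)

lemma4p9 : (k : ℕ) → 1 ≤ k → (L : IntervalListAssignment (2 * k + 1)) →
    (Σ (Fin (2 * k + 1) → Colour) (IsL72Colouring (2 * k + 1) L)) ⇔ (¬ Uniform (2 * k + 1) L)
lemma4p9 k _ = subst (λ n → (L : IntervalListAssignment n) → Σ (Fin n → Colour) (IsL72Colouring n L) ⇔ (¬ Uniform n L))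
                     (+-comm 1 (2 * k)) (odd-cycle k)
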